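{- Let $m,n\ge 1$ be integers. Let $A_1$ and $B_1$ be orthogonal Latin squares of order $m$ on the symbol set $[m]$, and let $A_2$ and $B_2$ be orthogonal Latin squares of order $n$ on the symbol set $[n]$. Then the direct products $A_1\otimes A_2$ and $B_1\otimes B_2$ are doubly orthogonal quasi-Sudoku Latin squares of order $mn$. That is: they are orthogonal Latin squares of order $mn$ on the symbol set $[m]\times[n]$; after applying one common permutation of the rows to both squares, each of them is a quasi-Sudoku Latin square, all with respect to the same partition of the rows into $n$ classes of $m$ rows and of the columns into $m$ classes of $n$ columns; and there exist onto maps $\Pi_m:[m]\times[n]\to[m]$ and $\Pi_n:[m]\times[n]\to[n]$ such that in the $mn\times mn$ array whose $(i,j)$ cell is $\bigl(\Pi_m((A_1\otimes A_2)(i,j)),\,\Pi_n((B_1\otimes B_2)(i,j))\bigr)$, each of the $m\times n$ subarrays obtained by intersecting one of these row classes with one of these column classes contains each of the $mn$ ordered pairs $(x,y)$ with $x\in[m]$, $y\in[n]$ exactly once.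
   Context: Notation: $[k]=\{0,1,\dots,k-1\}$. A Latin square of order $k$ is a $k\times k$ array in which each element of a $k$-element symbol set occurs exactly once in each row and once in each column. Two Latin squares $A,B$ of the same order $k$ on the same symbol set $N$ are orthogonal if superimposing them yields each of the $k^2$ ordered pairs in $N\times N$ exactly once. Direct product: for Latin squares $A_1$ of order $m$ and $A_2$ of order $n$, $A_1\otimes A_2$ is the $mn\times mn$ array (rows and columns indexed $0,\dots,mn-1$) whose entry in row $np+s$ and column $nq+t$ is the pair $(A_1(p,q),A_2(s,t))$, for $0\le p,q\le m-1$, $0\le s,t\le n-1$; it is a Latin square on the symbol set $[m]\times[n]$. Quasi-Sudoku Latin square (order $mn$): a Latin square of order $mn$ whose rows can be partitioned into $n$ classes of $m$ rows each and whose columns can be partitioned into $m$ classes of $n$ columns each, such that for each row class and each column class the $m\times n$ subarray formed by their intersection contains each of the $mn$ symbols exactly once. Doubly orthogonal (order $mn$): two orthogonal Latin squares $A,B$ of order $mn$ with symbol set $N$ are doubly orthogonal if there exist projections $\Pi_m:N\to[m]$, $\Pi_n:N\to[n]$ such that the array of pairs $(\Pi_m(A(i,j)),\Pi_n(B(i,j)))$ can be partitioned into $m\times n$ subarrays each containing all $mn$ pairs of $[m]\times[n]$ exactly once. -}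

module Defs where

open import Data.Nat using (ℕ; _*_)
open import Data.Fin using (Fin; remQuot)
open import Data.Product using (Σ; ∃; ∃!; _×_; _,_; proj₁; proj₂)
open import Relation.Binary.PropositionalEquality using (_≡_)
open import Function.Bundles using (_↔_; Inverse)
open import Data.Fin.Permutation using (Permutation′; _⟨$⟩ʳ_)

Square : ℕ → Set → Set
Square k S = Fin k → Fin k → S

-- Latin square of order k on symbol set S: every symbol occurs exactly
-- once in each row and exactly once in each column (this forces |S| = k).
IsLatin : ∀ {S : Set} (k : ℕ) → Square k S → Set
IsLatin {S} k L =
  (∀ (i : Fin k) (x : S) → ∃! _≡_ (λ j → L i j ≡ x)) ×
  (∀ (j : Fin k) (x : S) → ∃! _≡_ (λ i → L i j ≡ x))

Orthogonal : ∀ {S : Set} (k : ℕ) → Square k S → Square k S → Set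
Orthogonal {S} k A B =
  ∀ (x y : S) → ∃! _≡_ (λ (c : Fin k × Fin k) →
    A (proj₁ c) (proj₂ c) ≡ x × B (proj₁ c) (proj₂ c) ≡ y)

-- Direct product: entry at row n*p+s, column n*q+t is (A₁ p q , A₂ s t).
-- remQuot n (n*p+s) = (p , s).
_⊗_ : ∀ {m n : ℕ} {S T : Set} → Square m S → Square n T → Square (m * n) (S × T)
_⊗_ {m} {n} A₁ A₂ r c with remQuot {m} n r | remQuot {m} n c
... | (p , s) | (q , t) = (A₁ p q , A₂ s t)

permRows : ∀ {k : ℕ} {S : Set} → Permutation′ k → Square k S → Square k S
permRows π L i j = L (π ⟨$⟩ʳ i) j

-- A partition of the mn rows into n classes of m rows each:
-- a bijection row ↦ (class index , position inside the class).
RowPartition : ℕ → ℕ → Set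
RowPartition m n = Fin (m * n) ↔ (Fin n × Fin m)

ColPartition : ℕ → ℕ → Set
ColPartition m n = Fin (m * n) ↔ (Fin m × Fin n)

rowClass : ∀ {m n} → RowPartition m n → Fin (m * n) → Fin n
rowClass R i = proj₁ (Inverse.to R i)

colClass : ∀ {m n} → ColPartition m n → Fin (m * n) → Fin m
colClass C j = proj₁ (Inverse.to C j)

SubarraysComplete : ∀ {m n : ℕ} {S : Set} → RowPartition m n → ColPartition m n →
                    Square (m * n) S → Set
SubarraysComplete {m} {n} {S} R C L =
  ∀ (a : Fin n) (b : Fin m) (x : S) →
    ∃! _≡_ (λ (c : Fin (m * n) × Fin (m * n)) →
      rowClass R (proj₁ c) ≡ a × colClass C (proj₂ c) ≡ b × L (proj₁ c) (proj₂ c) ≡ x)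

IsQuasiSudokuWrt : ∀ {m n : ℕ} {S : Set} → RowPartition m n → ColPartition m n →
                   Square (m * n) S → Set
IsQuasiSudokuWrt {m} {n} R C L = IsLatin (m * n) L × SubarraysComplete R C L

Onto : ∀ {X Y : Set} → (X → Y) → Set
Onto {X} {Y} f = ∀ (y : Y) → ∃ λ (x : X) → f x ≡ y

IsDoublyOrthogonalWrt : ∀ {m n : ℕ} {S : Set} → RowPartition m n → ColPartition m n →
                        Square (m * n) S → Square (m * n) S → Set
IsDoublyOrthogonalWrt {m} {n} {S} R C A B =
  Orthogonal (m * n) A B ×
  Σ (S → Fin m) λ Πm → Σ (S → Fin n) λ Πn →
    Onto Πm × Onto Πn ×
    SubarraysComplete R C (λ i j → (Πm (A i j) , Πn (B i j)))

-- Index the mn rows by (p , s) and the mn columns by (q , t), as in the direct product,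
-- so that the cell ((p , s) , (q , t)) of A₁ ⊗ A₂ holds (A₁ p q , A₂ s t). A condition on
-- a cell then splits into a condition on (p , q) about A₁ and one on (s , t) about A₂,
-- and unique existence is preserved both by this reindexing and by taking products.
-- Grouping rows by s and columns by q, the subarray of class s = a and q = b is
-- {(p , t)} with entries (A₁ p b , A₂ a t): column b of A₁ fixes p and row a of A₂
-- fixes t. Taking Πm and Πn to be the two projections, the array of pairs
-- (Πm ((A₁ ⊗ A₂) i j) , Πn ((B₁ ⊗ B₂) i j)) is A₁ ⊗ B₂, so the same argument gives
-- double orthogonality; no row permutation is needed.
module Submission where

open import Defs
open import Data.Nat using (ℕ; _*_; _≤_)
open import Data.Fin using (Fin; remQuot; quotient; remainder; fromℕ<)
open import Data.Fin.Properties using (*↔×)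
open import Data.Fin.Permutation using (Permutation′)
import Data.Fin.Permutation as Permutation
open import Data.Product using (Σ; ∃!; _×_; _,_; proj₁; proj₂)
open import Data.Product.Algebra using (×-comm)
open import Data.Product.Function.NonDependent.Propositional using (_×-↔_; _×-⇔_)
open import Data.Product.Properties using (,-injective)
open import Function.Bundles using (_↔_; _⇔_; mk⇔; mk↔ₛ′; Inverse; Equivalence)
open import Function.Properties.Inverse using (↔⇒⇔)
open import Function.Construct.Composition using (_↔-∘_; _⇔-∘_)
open import Relation.Binary.PropositionalEquality

private
  variable
    A B C D X Y S T : Set

∃!-reindex : {P : X → Set} {Q : Y → Set} (e : X ↔ Y) →
  (∀ x → P x ⇔ Q (Inverse.to e x)) → ∃! _≡_ Q → ∃! _≡_ P
∃!-reindex {Q = Q} e P⇔Q (y , qy , unique) =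
  from y ,
  Equivalence.from (P⇔Q (from y)) (subst Q (sym (strictlyInverseˡ y)) qy) ,
  λ {x} px → trans (cong from (unique (Equivalence.to (P⇔Q x) px))) (strictlyInverseʳ x)
  where open Inverse e

∃!-× : {P : X → Set} {Q : Y → Set} →
  ∃! _≡_ P → ∃! _≡_ Q → ∃! _≡_ (λ (z : X × Y) → P (proj₁ z) × Q (proj₂ z))
∃!-× (x , px , uniqueˣ) (y , qy , uniqueʸ) =
  (x , y) , (px , qy) , λ (px′ , qy′) → cong₂ _,_ (uniqueˣ px′) (uniqueʸ qy′)

∃!-fixʳ : {P : X → Y → Set} (b : Y) →
  ∃! _≡_ (λ x → P x b) → ∃! _≡_ (λ (z : X × Y) → proj₂ z ≡ b × P (proj₁ z) (proj₂ z))
∃!-fixʳ b (x , px , unique) =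
  (x , b) , (refl , px) , λ { (refl , px′) → cong (_, b) (unique px′) }

∃!-fixˡ : {P : X → Y → Set} (a : X) →
  ∃! _≡_ (λ y → P a y) → ∃! _≡_ (λ (z : X × Y) → proj₁ z ≡ a × P (proj₁ z) (proj₂ z))
∃!-fixˡ a (y , py , unique) =
  (a , y) , (refl , py) , λ { (refl , py′) → cong (a ,_) (unique py′) }

×-interchange↔ : ((A × B) × (C × D)) ↔ ((A × C) × (B × D))
×-interchange↔ = mk↔ₛ′ interchange interchange (λ _ → refl) (λ _ → refl)
  where
  interchange : ∀ {A B C D : Set} → (A × B) × (C × D) → (A × C) × (B × D)
  interchange ((a , b) , (c , d)) = ((a , c) , (b , d))

proj₁-onto : Y → Onto (proj₁ {A = X} {B = λ _ → Y})
proj₁-onto y x = (x , y) , refl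

proj₂-onto : X → Onto (proj₂ {A = X} {B = λ _ → Y})
proj₂-onto x y = (x , y) , refl

RowLatin : ∀ k → Square k S → Set
RowLatin {S} k L = ∀ i (x : S) → ∃! _≡_ (λ j → L i j ≡ x)

ColumnLatin : ∀ k → Square k S → Set
ColumnLatin {S} k L = ∀ j (x : S) → ∃! _≡_ (λ i → L i j ≡ x)

subarraysComplete-cong : ∀ {m n} {K L : Square (m * n) S}
  (R : RowPartition m n) (C : ColPartition m n) →
  (∀ i j → K i j ≡ L i j) → SubarraysComplete R C K → SubarraysComplete R C L
subarraysComplete-cong R C K≡L complete a b x with complete a b x
... | (i , j) , (ra , cb , Kx) , unique =
  (i , j) , (ra , cb , trans (sym (K≡L i j)) Kx) ,
  λ { (ra′ , cb′ , Lx) → unique (ra′ , cb′ , trans (K≡L _ _) Lx) }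

module _ {m n : ℕ} where

  block : Fin (m * n) → Fin m
  block = quotient n

  offset : Fin (m * n) → Fin n
  offset = remainder {m} n

  cells↔ : (Fin (m * n) × Fin (m * n)) ↔ ((Fin m × Fin m) × (Fin n × Fin n))
  cells↔ = ×-interchange↔ ↔-∘ (*↔× ×-↔ *↔×)

  rowsByOffset : RowPartition m n
  rowsByOffset = ×-comm (Fin m) (Fin n) ↔-∘ *↔×

  ⊗-entry : (F : Square m S) (G : Square n T) →
    ∀ r c → (F ⊗ G) r c ≡ (F (block r) (block c) , G (offset r) (offset c))
  ⊗-entry F G r c with remQuot {m} n r | remQuot {m} n c
  ... | _ | _ = refl

  ⊗-entry-≡-⇔ : (F : Square m S) (G : Square n T) → ∀ r c x y →
    ((F ⊗ G) r c ≡ (x , y)) ⇔ (F (block r) (block c) ≡ x × G (offset r) (offset c) ≡ y)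
  ⊗-entry-≡-⇔ F G r c x y = mk⇔
    (λ eq → ,-injective (trans (sym (⊗-entry F G r c)) eq))
    (λ (eqˡ , eqʳ) → trans (⊗-entry F G r c) (cong₂ _,_ eqˡ eqʳ))

  module _ {F : Square m S} {G : Square n T} where

    ⊗-rowLatin : RowLatin m F → RowLatin n G → RowLatin (m * n) (F ⊗ G)
    ⊗-rowLatin Fr Gr r (x , y) =
      ∃!-reindex *↔× (λ c → ⊗-entry-≡-⇔ F G r c x y) (∃!-× (Fr (block r) x) (Gr (offset r) y))

    ⊗-columnLatin : ColumnLatin m F → ColumnLatin n G → ColumnLatin (m * n) (F ⊗ G)
    ⊗-columnLatin Fc Gc c (x , y) =
      ∃!-reindex *↔× (λ r → ⊗-entry-≡-⇔ F G r c x y) (∃!-× (Fc (block c) x) (Gc (offset c) y))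

    ⊗-isLatin : IsLatin m F → IsLatin n G → IsLatin (m * n) (F ⊗ G)
    ⊗-isLatin (Fr , Fc) (Gr , Gc) = ⊗-rowLatin Fr Gr , ⊗-columnLatin Fc Gc

    ⊗-subarraysComplete : ColumnLatin m F → RowLatin n G →
      SubarraysComplete rowsByOffset *↔× (F ⊗ G)
    ⊗-subarraysComplete Fc Gr a b (x , y) =
      ∃!-reindex cells↔ (λ (r , c) → split r c) (∃!-× (∃!-fixʳ b (Fc b x)) (∃!-fixˡ a (Gr a y)))
      where
      split : ∀ r c →
        (offset r ≡ a × block c ≡ b × (F ⊗ G) r c ≡ (x , y)) ⇔
        ((block c ≡ b × F (block r) (block c) ≡ x) ×
         (offset r ≡ a × G (offset r) (offset c) ≡ y))
      split r c = mk⇔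
        (λ (ra , cb , eq) → let (eqˡ , eqʳ) = to eq in (cb , eqˡ) , (ra , eqʳ))
        (λ ((cb , eqˡ) , (ra , eqʳ)) → ra , cb , from (eqˡ , eqʳ))
        where open Equivalence (⊗-entry-≡-⇔ F G r c x y)

  ⊗-orthogonal : {F F′ : Square m S} {G G′ : Square n T} →
    Orthogonal m F F′ → Orthogonal n G G′ → Orthogonal (m * n) (F ⊗ G) (F′ ⊗ G′)
  ⊗-orthogonal {F = F} {F′} {G} {G′} oF oG (x , y) (x′ , y′) =
    ∃!-reindex cells↔ (λ (r , c) → split r c) (∃!-× (oF x x′) (oG y y′))
    where
    split : ∀ r c →
      ((F ⊗ G) r c ≡ (x , y) × (F′ ⊗ G′) r c ≡ (x′ , y′)) ⇔
      ((F (block r) (block c) ≡ x × F′ (block r) (block c) ≡ x′) ×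
       (G (offset r) (offset c) ≡ y × G′ (offset r) (offset c) ≡ y′))
    split r c = ↔⇒⇔ ×-interchange↔ ⇔-∘ (⊗-entry-≡-⇔ F G r c x y ×-⇔ ⊗-entry-≡-⇔ F′ G′ r c x′ y′)

  ⊗-projections : (F F′ : Square m S) (G G′ : Square n T) → ∀ i j →
    (proj₁ ((F ⊗ G) i j) , proj₂ ((F′ ⊗ G′) i j)) ≡ (F ⊗ G′) i j
  ⊗-projections F F′ G G′ i j =
    trans (cong₂ _,_ (cong proj₁ (⊗-entry F G i j)) (cong proj₂ (⊗-entry F′ G′ i j))) (sym (⊗-entry F G′ i j))

proposition2 : ∀ (m n : ℕ) → 1 ≤ m → 1 ≤ n →
    (A₁ B₁ : Square m (Fin m)) (A₂ B₂ : Square n (Fin n)) →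
    IsLatin m A₁ → IsLatin m B₁ → Orthogonal m A₁ B₁ →
    IsLatin n A₂ → IsLatin n B₂ → Orthogonal n A₂ B₂ →
    IsLatin (m * n) (A₁ ⊗ A₂) × IsLatin (m * n) (B₁ ⊗ B₂) ×
    Orthogonal (m * n) (A₁ ⊗ A₂) (B₁ ⊗ B₂) ×
    Σ (Permutation′ (m * n)) (λ π →
      Σ (RowPartition m n) (λ R →
        Σ (ColPartition m n) (λ C →
          IsQuasiSudokuWrt R C (permRows π (A₁ ⊗ A₂)) ×
          IsQuasiSudokuWrt R C (permRows π (B₁ ⊗ B₂)) ×
          IsDoublyOrthogonalWrt R C (permRows π (A₁ ⊗ A₂)) (permRows π (B₁ ⊗ B₂)))))
proposition2 m n 1≤m 1≤n A₁ B₁ A₂ B₂ latinA₁ latinB₁ orthogonal₁ latinA₂ latinB₂ orthogonal₂ =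
  latinA , latinB , orthogonal ,
  Permutation.id , rowsByOffset , *↔× ,
  (latinA , ⊗-subarraysComplete (proj₂ latinA₁) (proj₁ latinA₂)) ,
  (latinB , ⊗-subarraysComplete (proj₂ latinB₁) (proj₁ latinB₂)) ,
  (orthogonal , proj₁ , proj₂ , proj₁-onto (fromℕ< 1≤n) , proj₂-onto (fromℕ< 1≤m) ,
    subarraysComplete-cong rowsByOffset *↔× (⊗-projections A₁ B₁ A₂ B₂)
      (⊗-subarraysComplete (proj₂ latinA₁) (proj₁ latinB₂)))
  where
  latinA : IsLatin (m * n) (A₁ ⊗ A₂)
  latinA = ⊗-isLatin latinA₁ latinA₂

  latinB : IsLatin (m * n) (B₁ ⊗ B₂)
  latinB = ⊗-isLatin latinB₁ latinB₂

  orthogonal : Orthogonal (m * n) (A₁ ⊗ A₂) (B₁ ⊗ B₂)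
  orthogonal = ⊗-orthogonal orthogonal₁ orthogonal₂
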